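{- For all integers $p\ge2$ and $n\ge1$, $$a_{n,p,012}=a_{n,p-1,012}+\sum_{k=2}^n a_{k-1,p-1,012}\,2^{n-k}.$$
   Context: For a finite integer sequence $(a_1,\dots,a_i)$, $\mathrm{asc}(a_1,\dots,a_i)=|\{j:1\le j<i,\ a_j<a_{j+1}\}|$. For an integer $p\ge1$, a $p$-ascent sequence of length $n\ge1$ is a sequence $(a_1,\dots,a_n)$ of nonnegative integers with $a_1=0$ and $a_i\le p+\mathrm{asc}(a_1,\dots,a_{i-1})$ for all $2\le i\le n$. A sequence $w=w_1\dots w_n$ avoids the pattern $012$ if there are no indices $i<j<k$ with $w_i<w_j<w_k$. $a_{n,p,012}$ is the number of $p$-ascent sequences of length $n$ avoiding $012$. -}

module Defs where

open import Data.Nat using (ℕ; zero; suc; _+_; _*_; _^_; _<ᵇ_; _≤ᵇ_; _∸_)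
open import Data.Bool using (Bool; true; false; _∧_; _∨_; not; if_then_else_)
open import Data.List using (List; []; _∷_; length; filter; map; concatMap; upTo)
open import Data.Nat.ListAction using (sum)
open import Data.Fin using (Fin)

asc : List ℕ → ℕ
asc [] = 0
asc (x ∷ []) = 0
asc (x ∷ y ∷ ys) = (if x <ᵇ y then 1 else 0) + asc (y ∷ ys)

ascentOK : ℕ → List ℕ → List ℕ → Bool
ascentOK p pref [] = true
ascentOK p pref (x ∷ xs) = (x ≤ᵇ (p + asc pref)) ∧ ascentOK p (pref Data.List.++ (x ∷ [])) xs

isPAscent : ℕ → List ℕ → Bool
isPAscent p [] = false
isPAscent p (zero ∷ xs) = ascentOK p (zero ∷ []) xs
isPAscent p (suc _ ∷ xs) = false

anyB : (ℕ → Bool) → List ℕ → Bool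
anyB f [] = false
anyB f (x ∷ xs) = f x ∨ anyB f xs

hasIncPairAbove : ℕ → List ℕ → Bool
hasIncPairAbove a [] = false
hasIncPairAbove a (y ∷ ys) =
  ((a <ᵇ y) ∧ anyB (λ z → y <ᵇ z) ys) ∨ hasIncPairAbove a ys

contains012 : List ℕ → Bool
contains012 [] = false
contains012 (x ∷ xs) = hasIncPairAbove x xs ∨ contains012 xs

avoids012 : List ℕ → Bool
avoids012 w = not (contains012 w)

allLists : ℕ → ℕ → List (List ℕ)
allLists b zero = [] ∷ []
allLists b (suc n) = concatMap (λ x → map (x ∷_) (allLists b n)) (upTo (suc b))

-- entries of a p-ascent sequence of length n are ≤ p + (n - 1) ≤ p + n,
-- so enumerating entries in {0..p+n} covers all of them.
pAscentSeqs : ℕ → ℕ → List (List ℕ)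
pAscentSeqs n p = filter (λ w → Data.Bool._≟_ (isPAscent p w) true) (allLists (p + n) n)

a012 : ℕ → ℕ → ℕ
a012 n p = length (filter (λ w → Data.Bool._≟_ (avoids012 w) true) (pAscentSeqs n p))

sumFrom2 : ℕ → (ℕ → ℕ) → ℕ
sumFrom2 n f = sum (map (λ i → f (i + 2)) (upTo (n ∸ 1)))

-- A sequence 0 a₂ … aₙ avoids 012 iff its nonzero entries are weakly decreasing. As long as only
-- zeros have been read there is no ascent, so the p-ascent condition bounds the first nonzero entry by
-- p, after which it holds automatically. Hence a_{m+1,p} = D_m(p) (descCount m p), the number of
-- words of length m whose nonzero entries are weakly decreasing and at most p. Splitting on the first
-- letter gives D_{m+1}(c) = D_m(c) + Σ_{v=1}^{c} D_m(v), and an induction on m using this recurrence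
-- yields D_m(q+1) = D_m(q) + Σ_{i<m} D_i(q) 2^{m-1-i}.

module Submission where

open import Defs
open import Data.Nat using (ℕ; _+_; _*_; _^_; _∸_; _≤_)
open import Relation.Binary.PropositionalEquality using (_≡_)

open import Data.Nat using (zero; suc; _<_; _<ᵇ_; _≤ᵇ_; z≤n; s≤s)
open import Data.Nat.Properties
  using (≤-refl; ≤-trans; ≤⇒≯; m<n⇒m<1+n; m≤m+n; +-monoʳ-≤; +-comm; +-assoc; +-suc; +-identityʳ;
         *-zeroʳ; *-distribˡ-+; m+[n∸m]≡n; n∸n≡0; +-∸-assoc; <ᵇ⇒<; <⇒<ᵇ; <ᵇ-reflects-<)
open import Data.Nat.ListAction using (sum)
open import Data.Nat.ListAction.Properties using (sum-++)
open import Data.Nat.Tactic.RingSolver using (solve-∀)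
open import Data.Bool using (Bool; true; false; _∧_; _∨_; not; if_then_else_; _≟_)
open import Data.Bool.Properties
  using (∧-zeroʳ; ∧-identityʳ; ∨-zeroʳ; ∨-comm; ∧-conicalˡ; ∧-conicalʳ; T-≡)
open import Data.List using (List; []; _∷_; _++_; _∷ʳ_; length; filter; map; concatMap; upTo)
open import Data.List.Properties using (upTo-∷ʳ; map-++)
open import Function using (_∘_)
open import Function.Bundles using (module Equivalence)
open import Relation.Nullary using (contradiction)
open import Relation.Nullary.Reflects using (ofʸ; ofⁿ)
open import Relation.Binary.PropositionalEquality
  using (refl; sym; trans; cong; cong₂; module ≡-Reasoning)

∨-trueʳ : ∀ a {b} → b ≡ true → a ∨ b ≡ true
∨-trueʳ a b≡true = trans (cong (a ∨_) b≡true) (∨-zeroʳ a)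

∨-absorbˡ : ∀ a b → (a ≡ true → b ≡ true) → a ∨ b ≡ b
∨-absorbˡ true  b a⇒b = sym (a⇒b refl)
∨-absorbˡ false b a⇒b = refl

∨-absorbʳ : ∀ a b → (b ≡ true → a ≡ true) → a ∨ b ≡ a
∨-absorbʳ a b b⇒a = trans (∨-comm a b) (∨-absorbˡ b a b⇒a)

∧-absorbˡ : ∀ a b → (b ≡ true → a ≡ true) → a ∧ b ≡ b
∧-absorbˡ a false b⇒a = ∧-zeroʳ a
∧-absorbˡ a true  b⇒a = trans (∧-identityʳ a) (b⇒a refl)

<ᵇ≡true⇒< : ∀ m n → (m <ᵇ n) ≡ true → m < n
<ᵇ≡true⇒< m n m<ᵇn = <ᵇ⇒< m n (Equivalence.from T-≡ m<ᵇn)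

<⇒<ᵇ≡true : ∀ {m n} → m < n → (m <ᵇ n) ≡ true
<⇒<ᵇ≡true m<n = Equivalence.to T-≡ (<⇒<ᵇ m<n)

m<ᵇ1+n≡not[n<ᵇm] : ∀ m n → (m <ᵇ suc n) ≡ not (n <ᵇ m)
m<ᵇ1+n≡not[n<ᵇm] zero    n       = refl
m<ᵇ1+n≡not[n<ᵇm] (suc m) zero    = refl
m<ᵇ1+n≡not[n<ᵇm] (suc m) (suc n) = m<ᵇ1+n≡not[n<ᵇm] m n

asc≤asc-∷ʳ : ∀ xs x → asc xs ≤ asc (xs ∷ʳ x)
asc≤asc-∷ʳ []           x = z≤n
asc≤asc-∷ʳ (y ∷ [])     x = z≤n
asc≤asc-∷ʳ (y ∷ z ∷ zs) x = +-monoʳ-≤ _ (asc≤asc-∷ʳ (z ∷ zs) x)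

asc-∷ʳ0 : ∀ xs → asc (xs ∷ʳ 0) ≡ asc xs
asc-∷ʳ0 []           = refl
asc-∷ʳ0 (y ∷ [])     = refl
asc-∷ʳ0 (y ∷ z ∷ zs) = cong (_ +_) (asc-∷ʳ0 (z ∷ zs))

anyB-mono : ∀ {f g} → (∀ z → f z ≡ true → g z ≡ true) → ∀ xs → anyB f xs ≡ true → anyB g xs ≡ true
anyB-mono {f} {g} f⇒g (x ∷ xs) any-f with f x in fx
... | true  = cong (_∨ anyB g xs) (f⇒g x fx)
... | false = ∨-trueʳ _ (anyB-mono f⇒g xs any-f)

hasIncPairAbove⇒hasIncPairAbove0 : ∀ a xs →
  hasIncPairAbove a xs ≡ true → hasIncPairAbove 0 xs ≡ true
hasIncPairAbove⇒hasIncPairAbove0 a (zero ∷ ys) pair = hasIncPairAbove⇒hasIncPairAbove0 a ys pair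
hasIncPairAbove⇒hasIncPairAbove0 a (suc y ∷ ys) pair with a <ᵇ suc y | anyB (suc y <ᵇ_) ys
... | _     | true  = refl
... | true  | false = hasIncPairAbove⇒hasIncPairAbove0 a ys pair
... | false | false = hasIncPairAbove⇒hasIncPairAbove0 a ys pair

contains012⇒hasIncPairAbove0 : ∀ xs → contains012 xs ≡ true → hasIncPairAbove 0 xs ≡ true
contains012⇒hasIncPairAbove0 (x ∷ xs) pattern012 with hasIncPairAbove x xs in pair
... | true  = ∨-trueʳ _ (hasIncPairAbove⇒hasIncPairAbove0 x xs pair)
... | false = ∨-trueʳ _ (contains012⇒hasIncPairAbove0 xs pattern012)

avoids012-0∷ : ∀ xs → avoids012 (0 ∷ xs) ≡ not (hasIncPairAbove 0 xs)
avoids012-0∷ xs = cong not (∨-absorbʳ _ _ (contains012⇒hasIncPairAbove0 xs))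

nonzeroDescending≤ : ℕ → List ℕ → Bool
nonzeroDescending≤ c []           = true
nonzeroDescending≤ c (zero ∷ xs)  = nonzeroDescending≤ c xs
nonzeroDescending≤ c (suc v ∷ xs) = (suc v ≤ᵇ c) ∧ nonzeroDescending≤ (suc v) xs

not[above∨incPair]≡nonzeroDescending≤ : ∀ c xs →
  not (anyB (c <ᵇ_) xs ∨ hasIncPairAbove 0 xs) ≡ nonzeroDescending≤ c xs
not[above∨incPair]≡nonzeroDescending≤ c []          = refl
not[above∨incPair]≡nonzeroDescending≤ c (zero ∷ xs) = not[above∨incPair]≡nonzeroDescending≤ c xs
not[above∨incPair]≡nonzeroDescending≤ c (suc v ∷ xs)
  rewrite m<ᵇ1+n≡not[n<ᵇm] c v with v <ᵇ c in v<ᵇc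
... | false = refl
... | true  =
  trans (cong not (∨-absorbˡ _ _ aboveC⇒pair)) (not[above∨incPair]≡nonzeroDescending≤ (suc v) xs)
  where
  aboveC⇒pair : anyB (c <ᵇ_) xs ≡ true → anyB (suc v <ᵇ_) xs ∨ hasIncPairAbove 0 xs ≡ true
  aboveC⇒pair = cong (_∨ _) ∘ anyB-mono
    (λ z c<ᵇz → <⇒<ᵇ≡true (≤-trans (s≤s (<ᵇ≡true⇒< v c v<ᵇc)) (<ᵇ≡true⇒< c z c<ᵇz))) xs

nonzeroDescending≤⇒ascentOK : ∀ p c pref xs →
  nonzeroDescending≤ c xs ≡ true → c ≤ p + asc pref → ascentOK p pref xs ≡ true
nonzeroDescending≤⇒ascentOK p c pref []          desc c≤bound = refl
nonzeroDescending≤⇒ascentOK p c pref (zero ∷ xs) desc c≤bound =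
  nonzeroDescending≤⇒ascentOK p c (pref ∷ʳ 0) xs desc
    (≤-trans c≤bound (+-monoʳ-≤ p (asc≤asc-∷ʳ pref 0)))
nonzeroDescending≤⇒ascentOK p c pref (suc v ∷ xs) desc c≤bound =
  cong₂ _∧_ (<⇒<ᵇ≡true v<bound)
    (nonzeroDescending≤⇒ascentOK p (suc v) (pref ∷ʳ suc v) xs (∧-conicalʳ _ _ desc)
      (≤-trans v<bound (+-monoʳ-≤ p (asc≤asc-∷ʳ pref (suc v)))))
  where
  v<bound : v < p + asc pref
  v<bound = ≤-trans (<ᵇ≡true⇒< v c (∧-conicalˡ _ _ desc)) c≤bound

ascentOK∧noIncPair : ∀ p pref xs → asc pref ≡ 0 →
  ascentOK p pref xs ∧ not (hasIncPairAbove 0 xs) ≡ nonzeroDescending≤ p xs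
ascentOK∧noIncPair p pref []          asc≡0 = refl
ascentOK∧noIncPair p pref (zero ∷ xs) asc≡0 =
  ascentOK∧noIncPair p (pref ∷ʳ 0) xs (trans (asc-∷ʳ0 pref) asc≡0)
ascentOK∧noIncPair p pref (suc v ∷ xs) asc≡0
  rewrite asc≡0 | +-identityʳ p | not[above∨incPair]≡nonzeroDescending≤ (suc v) xs
  with v <ᵇ p in v<ᵇp
... | false = refl
... | true  = ∧-absorbˡ _ _ λ desc →
  nonzeroDescending≤⇒ascentOK p (suc v) (pref ∷ʳ suc v) xs desc
    (≤-trans (<ᵇ≡true⇒< v p v<ᵇp) (m≤m+n p _))

pAscent∧avoids012-0∷ : ∀ p xs → isPAscent p (0 ∷ xs) ∧ avoids012 (0 ∷ xs) ≡ nonzeroDescending≤ p xs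
pAscent∧avoids012-0∷ p xs =
  trans (cong (ascentOK p (0 ∷ []) xs ∧_) (avoids012-0∷ xs)) (ascentOK∧noIncPair p (0 ∷ []) xs refl)

∑ : ℕ → (ℕ → ℕ) → ℕ
∑ zero    f = 0
∑ (suc n) f = ∑ n f + f n

∑-cong-< : ∀ n {f g} → (∀ i → i < n → f i ≡ g i) → ∑ n f ≡ ∑ n g
∑-cong-< zero    f≗g = refl
∑-cong-< (suc n) f≗g = cong₂ _+_ (∑-cong-< n (λ i i<n → f≗g i (m<n⇒m<1+n i<n))) (f≗g n ≤-refl)

∑-cong : ∀ n {f g} → (∀ i → f i ≡ g i) → ∑ n f ≡ ∑ n g
∑-cong n f≗g = ∑-cong-< n (λ i _ → f≗g i)

∑-suc-head : ∀ n f → ∑ (suc n) f ≡ f 0 + ∑ n (f ∘ suc)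
∑-suc-head zero    f = +-comm 0 (f 0)
∑-suc-head (suc n) f = trans (cong (_+ f (suc n)) (∑-suc-head n f)) (+-assoc (f 0) _ _)

∑-distribˡ-* : ∀ n k f → ∑ n (λ i → k * f i) ≡ k * ∑ n f
∑-distribˡ-* zero    k f = sym (*-zeroʳ k)
∑-distribˡ-* (suc n) k f = trans (cong (_+ k * f n) (∑-distribˡ-* n k f)) (sym (*-distribˡ-+ k _ _))

∑-supported-below : ∀ {b c} f → (∀ i → c ≤ i → f i ≡ 0) → c ≤ b → ∑ b f ≡ ∑ c f
∑-supported-below {b} {c} f vanish c≤b =
  trans (cong (λ k → ∑ k f) (sym (m+[n∸m]≡n c≤b))) (∑-+ (b ∸ c))
  where
  ∑-+ : ∀ d → ∑ (c + d) f ≡ ∑ c f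
  ∑-+ zero    rewrite +-identityʳ c = refl
  ∑-+ (suc d) rewrite +-suc c d =
    trans (cong₂ _+_ (∑-+ d) (vanish (c + d) (m≤m+n c d))) (+-identityʳ _)

sum-map-upTo : ∀ n f → sum (map f (upTo n)) ≡ ∑ n f
sum-map-upTo zero    f = refl
sum-map-upTo (suc n) f = begin
  sum (map f (upTo (suc n)))      ≡⟨ cong (sum ∘ map f) (sym (upTo-∷ʳ n)) ⟩
  sum (map f (upTo n ∷ʳ n))       ≡⟨ cong sum (map-++ f (upTo n) (n ∷ [])) ⟩
  sum (map f (upTo n) ++ f n ∷ []) ≡⟨ sum-++ (map f (upTo n)) (f n ∷ []) ⟩
  sum (map f (upTo n)) + (f n + 0) ≡⟨ cong₂ _+_ (sum-map-upTo n f) (+-identityʳ (f n)) ⟩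
  ∑ n f + f n                      ∎
  where open ≡-Reasoning

∑-doubling : ∀ m (f : ℕ → ℕ) → ∑ m (λ i → f i * 2 ^ (m ∸ i)) ≡ 2 * ∑ m (λ i → f i * 2 ^ (m ∸ suc i))
∑-doubling m f = trans (∑-cong-< m halve) (∑-distribˡ-* m 2 (λ i → f i * 2 ^ (m ∸ suc i)))
  where
  halve : ∀ i → i < m → f i * 2 ^ (m ∸ i) ≡ 2 * (f i * 2 ^ (m ∸ suc i))
  halve i i<m =
    trans (cong (λ e → f i * 2 ^ e) (+-∸-assoc 1 {m} {suc i} i<m)) (*-left-comm (f i) (2 ^ (m ∸ suc i)))
    where
    *-left-comm : ∀ a b → a * (2 * b) ≡ 2 * (a * b)
    *-left-comm = solve-∀

count : (List ℕ → Bool) → List (List ℕ) → ℕ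
count P []       = 0
count P (w ∷ ws) = (if P w then 1 else 0) + count P ws

count-cong : ∀ {P Q} → (∀ w → P w ≡ Q w) → ∀ ws → count P ws ≡ count Q ws
count-cong P≗Q []       = refl
count-cong P≗Q (w ∷ ws) = cong₂ _+_ (cong (if_then 1 else 0) (P≗Q w)) (count-cong P≗Q ws)

count-false : ∀ ws → count (λ _ → false) ws ≡ 0
count-false []       = refl
count-false (w ∷ ws) = count-false ws

count-++ : ∀ P ws vs → count P (ws ++ vs) ≡ count P ws + count P vs
count-++ P []       vs = refl
count-++ P (w ∷ ws) vs =
  trans (cong (_ +_) (count-++ P ws vs)) (sym (+-assoc (if P w then 1 else 0) _ _))

count-map-∷ : ∀ P x ws → count P (map (x ∷_) ws) ≡ count (P ∘ (x ∷_)) ws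
count-map-∷ P x []       = refl
count-map-∷ P x (w ∷ ws) = cong (_ +_) (count-map-∷ P x ws)

count-concatMap-∷ : ∀ P ws xs →
  count P (concatMap (λ x → map (x ∷_) ws) xs) ≡ sum (map (λ x → count (P ∘ (x ∷_)) ws) xs)
count-concatMap-∷ P ws []       = refl
count-concatMap-∷ P ws (x ∷ xs) =
  trans (count-++ P (map (x ∷_) ws) _) (cong₂ _+_ (count-map-∷ P x ws) (count-concatMap-∷ P ws xs))

length-filter-filter : ∀ (P Q : List ℕ → Bool) ws →
  length (filter (λ w → Q w ≟ true) (filter (λ w → P w ≟ true) ws)) ≡ count (λ w → P w ∧ Q w) ws
length-filter-filter P Q []       = refl
length-filter-filter P Q (w ∷ ws) with P w
... | false = length-filter-filter P Q ws
... | true with Q w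
...   | false = length-filter-filter P Q ws
...   | true  = cong suc (length-filter-filter P Q ws)

count-allLists-suc : ∀ P b m →
  count P (allLists b (suc m))
    ≡ count (P ∘ (0 ∷_)) (allLists b m) + ∑ b (λ v → count (P ∘ (suc v ∷_)) (allLists b m))
count-allLists-suc P b m =
  trans (count-concatMap-∷ P (allLists b m) (upTo (suc b)))
    (trans (sum-map-upTo (suc b) _) (∑-suc-head b _))

descCount : ℕ → ℕ → ℕ
descCount zero    c = 1
descCount (suc m) c = descCount m c + ∑ c (λ v → descCount m (suc v))

count-nonzeroDescending≤ : ∀ m {b c} → c ≤ b →
  count (nonzeroDescending≤ c) (allLists b m) ≡ descCount m c
count-nonzeroDescending≤ zero    c≤b = refl
count-nonzeroDescending≤ (suc m) {b} {c} c≤b =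
  trans (count-allLists-suc (nonzeroDescending≤ c) b m)
    (cong₂ _+_ (count-nonzeroDescending≤ m c≤b)
      (trans (∑-supported-below leading vanish c≤b) (∑-cong-< c below)))
  where
  leading : ℕ → ℕ
  leading v = count (nonzeroDescending≤ c ∘ (suc v ∷_)) (allLists b m)

  vanish : ∀ v → c ≤ v → leading v ≡ 0
  vanish v c≤v with v <ᵇ c | <ᵇ-reflects-< v c
  ... | true  | ofʸ v<c = contradiction v<c (≤⇒≯ c≤v)
  ... | false | _       = count-false (allLists b m)

  below : ∀ v → v < c → leading v ≡ descCount m (suc v)
  below v v<c with v <ᵇ c | <ᵇ-reflects-< v c
  ... | true  | _       = count-nonzeroDescending≤ m (≤-trans v<c c≤b)
  ... | false | ofⁿ v≮c = contradiction v<c v≮c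

a012-suc : ∀ m p → a012 (suc m) p ≡ descCount m p
a012-suc m p = begin
  a012 (suc m) p
    ≡⟨ length-filter-filter (isPAscent p) avoids012 (allLists b (suc m)) ⟩
  count (λ w → isPAscent p w ∧ avoids012 w) (allLists b (suc m))
    ≡⟨ count-allLists-suc _ b m ⟩
  count (λ w → isPAscent p (0 ∷ w) ∧ avoids012 (0 ∷ w)) (allLists b m)
    + ∑ b (λ _ → count (λ _ → false) (allLists b m))
    ≡⟨ cong₂ _+_ (count-cong (pAscent∧avoids012-0∷ p) (allLists b m))
                  (∑-supported-below {b} {0} _ (λ _ _ → count-false (allLists b m)) z≤n) ⟩
  count (nonzeroDescending≤ p) (allLists b m) + 0
    ≡⟨ trans (+-identityʳ _) (count-nonzeroDescending≤ m (m≤m+n p (suc m))) ⟩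
  descCount m p ∎
  where
  open ≡-Reasoning
  b = p + suc m

descCount-suc : ∀ m q →
  descCount m (suc q) ≡ descCount m q + ∑ m (λ i → descCount i q * 2 ^ (m ∸ suc i))
descCount-suc zero    q = refl
descCount-suc (suc m) q = begin
  descCount m (suc q) + (T + descCount m (suc q))
    ≡⟨ cong (λ x → x + (T + x)) (descCount-suc m q) ⟩
  (G + S) + (T + (G + S))
    ≡⟨ rearrange G S T ⟩
  (G + T) + (2 * S + G * 1)
    ≡⟨ cong ((G + T) +_) (cong₂ _+_ (sym (∑-doubling m (λ i → descCount i q)))
                                   (cong (λ e → G * 2 ^ e) (sym (n∸n≡0 m)))) ⟩
  (G + T) + (∑ m (λ i → descCount i q * 2 ^ (m ∸ i)) + G * 2 ^ (m ∸ m)) ∎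
  where
  open ≡-Reasoning
  G = descCount m q
  T = ∑ q (λ v → descCount m (suc v))
  S = ∑ m (λ i → descCount i q * 2 ^ (m ∸ suc i))
  rearrange : ∀ g s t → (g + s) + (t + (g + s)) ≡ (g + t) + (2 * s + g * 1)
  rearrange = solve-∀

sumFrom2-suc : ∀ m (f : ℕ → ℕ) → sumFrom2 (suc m) f ≡ ∑ m (λ i → f (2 + i))
sumFrom2-suc m f = trans (sum-map-upTo m _) (∑-cong m (λ i → cong f (+-comm i 2)))

mainTheorem17 : (p n : ℕ) → 2 ≤ p → 1 ≤ n →
    a012 n p ≡ a012 n (p ∸ 1) + sumFrom2 n (λ k → a012 (k ∸ 1) (p ∸ 1) * 2 ^ (n ∸ k))
mainTheorem17 (suc q) (suc m) _ _ = begin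
  a012 (suc m) (suc q)
    ≡⟨ a012-suc m (suc q) ⟩
  descCount m (suc q)
    ≡⟨ descCount-suc m q ⟩
  descCount m q + ∑ m (λ i → descCount i q * 2 ^ (m ∸ suc i))
    ≡⟨ sym (cong₂ _+_ (a012-suc m q) (∑-cong m (λ i → cong (_* 2 ^ (m ∸ suc i)) (a012-suc i q)))) ⟩
  a012 (suc m) q + ∑ m (λ i → a012 (suc i) q * 2 ^ (m ∸ suc i))
    ≡⟨ cong (a012 (suc m) q +_) (sym (sumFrom2-suc m (λ k → a012 (k ∸ 1) q * 2 ^ (suc m ∸ k)))) ⟩
  a012 (suc m) q + sumFrom2 (suc m) (λ k → a012 (k ∸ 1) q * 2 ^ (suc m ∸ k)) ∎
  where open ≡-Reasoning
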